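{- Let $p$ be an odd prime, let $m$ be a positive integer not divisible by $p$, and let $\varepsilon\in\{1,-1\}$. Let $n$ be an integer (residue class modulo $p(p-1)$) such that $p^2\mid D_\varepsilon(n,m)$, let $k\equiv m-n\pmod{p(p-1)}$, and let $x$ be the unique $p$th power modulo $p^2$ such that $x\equiv 1-mn^{ -1}\pmod p$. Then $x^k\equiv-\varepsilon(1-x)^m\pmod{p^2}$, and $x-1$ is also a $p$th power modulo $p^2$.
   Context: $D_\varepsilon(n,m)=n^n+\varepsilon (n-m)^{n-m}m^m$ for positive integers $n>m$. Convention: for integers $n,m$ with $p\nmid m$, "$p^2\mid D_\varepsilon(n,m)$" means $p^2\mid D_\varepsilon(n',m')$ for positive integers $m'\equiv m$, $n'\equiv n\pmod{p(p-1)}$ with $n'>m'$ (independent of the choice). An integer $y$ is a $p$th power modulo $p^2$ if $y\equiv a^p\pmod{p^2}$ for some integer $a$. $n^{ -1}$ denotes an inverse of $n$ modulo $p$; negative powers denote powers of inverses modulo $p^2$. -}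

module Defs where

open import Data.Nat as ℕ using (ℕ)
open import Data.Integer using (ℤ; +_; _+_; _-_; _*_; _^_)
open import Data.Integer.Divisibility using (_∣_)

-- D_ε(n,m) = n^n + ε (n-m)^(n-m) m^m, for naturals n > m (the caller supplies n > m)
D : ℤ → ℕ → ℕ → ℤ
D ε n m = (+ (n ℕ.^ n)) + ε * (+ ((n ℕ.∸ m) ℕ.^ (n ℕ.∸ m) ℕ.* (m ℕ.^ m)))

infix 4 _≈_[mod_]
_≈_[mod_] : ℤ → ℤ → ℕ → Set
a ≈ b [mod q ] = (+ q) ∣ (a - b)

IsPthPowerModSq : ℕ → ℤ → Set
IsPthPowerModSq p y = Σ ℤ (λ a → y ≈ a ^ p [mod p ℕ.^ 2 ])
  where open import Data.Product using (Σ)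

-- the convention "p^2 ∣ D_ε(n,m)" for a residue class n modulo p(p-1):
-- p^2 ∣ D_ε(n',m') for some positive n' > m' with n' ≡ n, m' ≡ m (mod p(p-1))
-- (independent of the choice of representatives)
PSqDividesD : ℕ → ℤ → ℤ → ℤ → Set
PSqDividesD p ε n m =
  Σ ℕ λ n' → Σ ℕ λ m' →
    (0 ℕ.< m') × (m' ℕ.< n') ×
    ((+ n') ≈ n [mod p ℕ.* (p ℕ.∸ 1) ]) × ((+ m') ≈ m [mod p ℕ.* (p ℕ.∸ 1) ]) ×
    ((+ (p ℕ.^ 2)) ∣ D ε n' m')
  where open import Data.Product using (Σ; _×_)

-- Take representatives N > M > 0 of n and m, put V = N − M, let r be the given inverse of N
-- modulo p, and v = V r, w = M r. Since u^p ≡ u (mod p), one has u^u ≡ (u^p)^u (1 + u − u^p)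
-- (mod p²) for u > 0. Expanding the three self-powers in D_ε(N, M) ≡ 0 (mod p²) this way, and
-- cancelling against (N^p)^N ≡ −ε (V^p)^V (M^p)^M, the p-th power of D_ε(N, M) ≡ 0 (mod p),
-- leaves N^p ≡ V^p + M^p, that is v^p + w^p ≡ 1 (mod p²). Since x ≡ 1 − M r ≡ v (mod p) and x is
-- a p-th power, x ≡ v^p, hence 1 − x ≡ w^p and x − 1 ≡ (−w)^p. Modulo p, D_ε(N, M) ≡ 0 reads
-- 1 ≡ −ε v^V w^M; as k + V ≡ 0 and M ≡ m (mod p − 1), Fermat turns it into v^k ≡ −ε w^m, whose
-- p-th power is x^k ≡ −ε (1 − x)^m (mod p²).

{-# OPTIONS --safe #-}
module Submission where

open import Defs
open import Data.Nat as ℕ using (ℕ; zero; suc; _!)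
open import Data.Nat.Primality using (Prime; euclidsLemma; prime⇒nonTrivial)
open import Data.Integer using (ℤ; +_; -[1+_]; -_; _+_; _-_; _*_; _^_; 0ℤ; 1ℤ; -1ℤ; ∣_∣)
open import Data.Product using (Σ; _×_; _,_)
open import Data.Sum using (_⊎_; inj₁; inj₂)
open import Relation.Binary.PropositionalEquality
  using (_≡_; refl; sym; trans; cong; cong₂; subst; module ≡-Reasoning)
open import Relation.Nullary using (¬_)
open import Data.Nat.Divisibility as ℕD using ()

import Data.Nat.Properties as ℕ
open import Data.Nat.Combinatorics using (_C_; nCn≡1; k![n∸k]!∣n!)
open import Data.Nat.Combinatorics.Specification using (nCk≡n!/k![n-k]!)
open import Data.Nat.DivMod using (m/n*n≡m)
open import Data.Fin as Fin using (Fin; fromℕ; inject₁; toℕ)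
open import Data.Fin.Properties using (toℕ-fromℕ; toℕ-inject₁; toℕ<n)
open import Data.Integer.Properties
open import Data.Integer.Divisibility.Signed
  using (_∣_; divides; ∣ᵤ⇒∣; ∣⇒∣ᵤ; ∣-refl; ∣-trans; ∣m∣n⇒∣m+n; ∣m∣n⇒∣m-n; ∣m⇒∣-m; ∣m⇒∣m*n; ∣n⇒∣m*n)
open import Data.Integer.Tactic.RingSolver using (solve-∀)
open import Algebra.Properties.CommutativeSemiring.Binomial +-*-commutativeSemiring as Binomial
  using (binomialTerm; binomial)
open import Algebra.Properties.Semiring.Mult +-*-semiring using () renaming (_×_ to _×ˢ_)
open import Algebra.Properties.Semiring.Exp +-*-semiring using () renaming (_^_ to _^ˢ_)
open import Algebra.Properties.Semiring.Sum +-*-semiring using (sum)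
open import Data.Empty using (⊥-elim)
open import Function using (_∘_)
open import Level using (0ℓ)
open import Relation.Binary.Bundles using (Setoid)
import Relation.Binary.Reasoning.Setoid as SetoidReasoning

private variable
  a b c d u : ℤ
  q : ℕ

^-distrib-* : ∀ x y n → (x * y) ^ n ≡ x ^ n * y ^ n
^-distrib-* x y zero = refl
^-distrib-* x y (suc n) = trans (cong (x * y *_) (^-distrib-* x y n)) (swap x y (x ^ n) (y ^ n))
  where
  swap : ∀ x y s t → x * y * (s * t) ≡ x * s * (y * t)
  swap = solve-∀

^-comm : ∀ x m n → (x ^ m) ^ n ≡ (x ^ n) ^ m
^-comm x m n = trans (^-*-assoc x m n) (trans (cong (x ^_) (ℕ.*-comm m n)) (sym (^-*-assoc x n m)))

pos-^ : ∀ m n → + (m ℕ.^ n) ≡ (+ m) ^ n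
pos-^ m zero = refl
pos-^ m (suc n) = trans (pos-* m (m ℕ.^ n)) (cong (+ m *_) (pos-^ m n))

pos-m∸n+n : ∀ {m n} → n ℕ.≤ m → + m ≡ + (m ℕ.∸ n) + + n
pos-m∸n+n {m} {n} n≤m = trans (cong +_ (sym (ℕ.m∸n+n≡m n≤m))) (pos-+ (m ℕ.∸ n) n)

-1^odd : ∀ n → ¬ (2 ℕD.∣ n) → -1ℤ ^ n ≡ -1ℤ
-1^odd zero odd = ⊥-elim (odd (2 ℕD.∣0))
-1^odd (suc zero) _ = refl
-1^odd (suc (suc n)) odd =
  trans (sym (*-assoc -1ℤ -1ℤ (-1ℤ ^ n)))
        (trans (*-identityˡ (-1ℤ ^ n)) (-1^odd n (odd ∘ ℕD.∣m∣n⇒∣m+n ℕD.∣-refl)))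

^-neg-odd : ∀ n → ¬ (2 ℕD.∣ n) → ∀ x → (- x) ^ n ≡ - (x ^ n)
^-neg-odd n odd x = begin
  (- x) ^ n          ≡⟨ cong (_^ n) (sym (-1*i≡-i x)) ⟩
  (-1ℤ * x) ^ n      ≡⟨ ^-distrib-* -1ℤ x n ⟩
  -1ℤ ^ n * x ^ n    ≡⟨ cong (_* x ^ n) (-1^odd n odd) ⟩
  -1ℤ * x ^ n        ≡⟨ -1*i≡-i (x ^ n) ⟩
  - (x ^ n)          ∎
  where open ≡-Reasoning

neg-sign^odd : ∀ {ε} n → ε ≡ + 1 ⊎ ε ≡ - (+ 1) → ¬ (2 ℕD.∣ n) → (- ε) ^ n ≡ - ε
neg-sign^odd n (inj₁ refl) odd = -1^odd n odd
neg-sign^odd n (inj₂ refl) odd = ^-zeroˡ n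

-- Congruences modulo a natural number

-- A record rather than the _≈_[mod_] of Defs, so that both sides can be inferred from a proof.
infix 4 _≋_⟨mod_⟩
record _≋_⟨mod_⟩ (a b : ℤ) (q : ℕ) : Set where
  constructor congruent
  field divides-difference : + q ∣ a - b
open _≋_⟨mod_⟩ public

≈⇒≋ : a ≈ b [mod q ] → a ≋ b ⟨mod q ⟩
≈⇒≋ h = congruent (∣ᵤ⇒∣ h)

≋⇒≈ : a ≋ b ⟨mod q ⟩ → a ≈ b [mod q ]
≋⇒≈ h = ∣⇒∣ᵤ (divides-difference h)

∣-resp-≡ : a ∣ b → b ≡ c → a ∣ c
∣-resp-≡ h refl = h

≋-refl : a ≋ a ⟨mod q ⟩
≋-refl {a = a} {q = q} = congruent (∣-resp-≡ (divides 0ℤ (sym (*-zeroˡ (+ q)))) (sym (+-inverseʳ a)))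

≋-reflexive : a ≡ b → a ≋ b ⟨mod q ⟩
≋-reflexive refl = ≋-refl

≋-sym : a ≋ b ⟨mod q ⟩ → b ≋ a ⟨mod q ⟩
≋-sym {a = a} {b = b} (congruent h) = congruent (∣-resp-≡ (∣m⇒∣-m h) (negate a b))
  where
  negate : ∀ a b → - (a - b) ≡ b - a
  negate = solve-∀

≋-trans : a ≋ b ⟨mod q ⟩ → b ≋ c ⟨mod q ⟩ → a ≋ c ⟨mod q ⟩
≋-trans {a = a} {b = b} {c = c} (congruent h) (congruent k) =
  congruent (∣-resp-≡ (∣m∣n⇒∣m+n h k) (telescope a b c))
  where
  telescope : ∀ a b c → (a - b) + (b - c) ≡ a - c
  telescope = solve-∀

≋-setoid : ℕ → Setoid 0ℓ 0ℓ
≋-setoid q = record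
  { Carrier = ℤ
  ; _≈_ = _≋_⟨mod q ⟩
  ; isEquivalence = record { refl = ≋-refl ; sym = ≋-sym ; trans = ≋-trans }
  }

module ≋-Reasoning (q : ℕ) = SetoidReasoning (≋-setoid q)

+-cong-≋ : a ≋ b ⟨mod q ⟩ → c ≋ d ⟨mod q ⟩ → a + c ≋ b + d ⟨mod q ⟩
+-cong-≋ {a = a} {b = b} {c = c} {d = d} (congruent h) (congruent k) =
  congruent (∣-resp-≡ (∣m∣n⇒∣m+n h k) (regroup a b c d))
  where
  regroup : ∀ a b c d → (a - b) + (c - d) ≡ (a + c) - (b + d)
  regroup = solve-∀

*-cong-≋ : a ≋ b ⟨mod q ⟩ → c ≋ d ⟨mod q ⟩ → a * c ≋ b * d ⟨mod q ⟩
*-cong-≋ {a = a} {b = b} {c = c} {d = d} (congruent h) (congruent k) =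
  congruent (∣-resp-≡ (∣m∣n⇒∣m+n (∣m⇒∣m*n c h) (∣n⇒∣m*n b k)) (regroup a b c d))
  where
  regroup : ∀ a b c d → (a - b) * c + b * (c - d) ≡ a * c - b * d
  regroup = solve-∀

+-congˡ-≋ : ∀ c → a ≋ b ⟨mod q ⟩ → c + a ≋ c + b ⟨mod q ⟩
+-congˡ-≋ c = +-cong-≋ (≋-refl {c})

*-congˡ-≋ : ∀ c → a ≋ b ⟨mod q ⟩ → c * a ≋ c * b ⟨mod q ⟩
*-congˡ-≋ c = *-cong-≋ (≋-refl {c})

*-congʳ-≋ : ∀ c → a ≋ b ⟨mod q ⟩ → a * c ≋ b * c ⟨mod q ⟩
*-congʳ-≋ c h = *-cong-≋ h (≋-refl {c})

-‿cong-≋ : a ≋ b ⟨mod q ⟩ → - a ≋ - b ⟨mod q ⟩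
-‿cong-≋ {a = a} {b = b} (congruent h) = congruent (∣-resp-≡ (∣m⇒∣-m h) (regroup a b))
  where
  regroup : ∀ a b → - (a - b) ≡ - a - - b
  regroup = solve-∀

-cong-≋ : a ≋ b ⟨mod q ⟩ → c ≋ d ⟨mod q ⟩ → a - c ≋ b - d ⟨mod q ⟩
-cong-≋ h k = +-cong-≋ h (-‿cong-≋ k)

^-congˡ-≋ : ∀ n → a ≋ b ⟨mod q ⟩ → a ^ n ≋ b ^ n ⟨mod q ⟩
^-congˡ-≋ zero h = ≋-refl
^-congˡ-≋ (suc n) h = *-cong-≋ h (^-congˡ-≋ n h)

∣⇒≋0 : + q ∣ a → a ≋ 0ℤ ⟨mod q ⟩
∣⇒≋0 {a = a} h = congruent (∣-resp-≡ h (sym (+-identityʳ a)))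

≋0⇒∣ : a ≋ 0ℤ ⟨mod q ⟩ → + q ∣ a
≋0⇒∣ {a = a} (congruent h) = ∣-resp-≡ h (+-identityʳ a)

≋-weaken : ∀ {r} → q ℕD.∣ r → a ≋ b ⟨mod r ⟩ → a ≋ b ⟨mod q ⟩
≋-weaken q∣r (congruent h) = congruent (∣-trans (∣ᵤ⇒∣ q∣r) h)

≋-weaken-sq : a ≋ b ⟨mod q ℕ.^ 2 ⟩ → a ≋ b ⟨mod q ⟩
≋-weaken-sq {q = q} = ≋-weaken (ℕD.m∣m*n (q ℕ.* 1))

∣-sq : + q ∣ a → + q ∣ b → + (q ℕ.^ 2) ∣ a * b
∣-sq {q = q} {a = a} {b = b} h k = ∣ᵤ⇒∣ (subst (ℕD._∣ ∣ a * b ∣) (cong (q ℕ.*_) (sym (ℕ.*-identityʳ q)))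
  (subst ((q ℕ.* q) ℕD.∣_) (sym (abs-* a b)) (ℕD.*-pres-∣ (∣⇒∣ᵤ h) (∣⇒∣ᵤ k))))

*-congʳ-≋-sq : + q ∣ c → a ≋ b ⟨mod q ⟩ → a * c ≋ b * c ⟨mod q ℕ.^ 2 ⟩
*-congʳ-≋-sq {q = q} {c = c} {a = a} {b = b} q∣c (congruent h) = congruent (∣-resp-≡ (∣-sq h q∣c) (distrib a b c))
  where
  distrib : ∀ a b c → (a - b) * c ≡ a * c - b * c
  distrib = solve-∀

[1+a][1+b]≋1+a+b : + q ∣ a → + q ∣ b → (1ℤ + a) * (1ℤ + b) ≋ 1ℤ + a + b ⟨mod q ℕ.^ 2 ⟩
[1+a][1+b]≋1+a+b {q = q} {a = a} {b = b} q∣a q∣b = begin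
  (1ℤ + a) * (1ℤ + b)     ≡⟨ expand a b ⟩
  1ℤ + a + b + a * b      ≈⟨ +-congˡ-≋ (1ℤ + a + b) (∣⇒≋0 (∣-sq q∣a q∣b)) ⟩
  1ℤ + a + b + 0ℤ         ≡⟨ +-identityʳ (1ℤ + a + b) ⟩
  1ℤ + a + b              ∎
  where
  open ≋-Reasoning (q ℕ.^ 2)
  expand : ∀ a b → (1ℤ + a) * (1ℤ + b) ≡ 1ℤ + a + b + a * b
  expand = solve-∀

invertible-cancelˡ-≋ : ∀ {v} → u * v ≋ 1ℤ ⟨mod q ⟩ → u * a ≋ u * b ⟨mod q ⟩ → a ≋ b ⟨mod q ⟩
invertible-cancelˡ-≋ {u = u} {q = q} {a = a} {b = b} {v = v} uv≋1 ua≋ub = begin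
  a             ≡⟨ sym (*-identityˡ a) ⟩
  1ℤ * a        ≈⟨ *-congʳ-≋ a uv≋1 ⟨
  u * v * a     ≡⟨ shuffle u v a ⟩
  v * (u * a)   ≈⟨ *-congˡ-≋ v ua≋ub ⟩
  v * (u * b)   ≡⟨ sym (shuffle u v b) ⟩
  u * v * b     ≈⟨ *-congʳ-≋ b uv≋1 ⟩
  1ℤ * b        ≡⟨ *-identityˡ b ⟩
  b             ∎
  where
  open ≋-Reasoning q
  shuffle : ∀ u v a → u * v * a ≡ v * (u * a)
  shuffle = solve-∀

∤-cong : a ≋ b ⟨mod q ⟩ → ¬ (+ q ∣ b) → ¬ (+ q ∣ a)
∤-cong {a = a} {b = b} (congruent q∣a-b) q∤b q∣a = q∤b (∣-resp-≡ (∣m∣n⇒∣m-n q∣a q∣a-b) (cancel a b))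
  where
  cancel : ∀ a b → a - (a - b) ≡ b
  cancel = solve-∀

-- Primes and the little Fermat theorem

prime>1 : ∀ {p} → Prime p → 1 ℕ.< p
prime>1 {p = p} p-prime = ℕ.nonTrivial⇒n>1 p {{prime⇒nonTrivial p-prime}}

prime-euclid : ∀ {p} → Prime p → + p ∣ a * b → (+ p ∣ a) ⊎ (+ p ∣ b)
prime-euclid {a = a} {b = b} p-prime h
  with euclidsLemma ∣ a ∣ ∣ b ∣ p-prime (subst (_ ℕD.∣_) (abs-* a b) (∣⇒∣ᵤ h))
... | inj₁ p∣a = inj₁ (∣ᵤ⇒∣ p∣a)
... | inj₂ p∣b = inj₂ (∣ᵤ⇒∣ p∣b)

prime∤1 : ∀ {p} → Prime p → ¬ (+ p ∣ 1ℤ)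
prime∤1 p-prime h = ℕ.<-irrefl (sym (ℕD.∣1⇒≡1 (∣⇒∣ᵤ h))) (prime>1 p-prime)

∣*∤⇒∣ : ∀ {p} → Prime p → ¬ (+ p ∣ u) → + p ∣ u * a → + p ∣ a
∣*∤⇒∣ p-prime p∤u p∣ua with prime-euclid p-prime p∣ua
... | inj₁ p∣u = ⊥-elim (p∤u p∣u)
... | inj₂ p∣a = p∣a

∤-* : ∀ {p} → Prime p → ¬ (+ p ∣ a) → ¬ (+ p ∣ b) → ¬ (+ p ∣ a * b)
∤-* p-prime p∤a p∤b = p∤b ∘ ∣*∤⇒∣ p-prime p∤a

∤-^ : ∀ {p} → Prime p → ∀ n → ¬ (+ p ∣ a) → ¬ (+ p ∣ a ^ n)
∤-^ p-prime zero p∤a = prime∤1 p-prime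
∤-^ p-prime (suc n) p∤a = ∤-* p-prime p∤a (∤-^ p-prime n p∤a)

invertible⇒∤ : ∀ {p} → Prime p → a * b ≋ 1ℤ ⟨mod p ⟩ → ¬ (+ p ∣ a)
invertible⇒∤ {a = a} {b = b} p-prime (congruent h) p∣a =
  prime∤1 p-prime (∣-resp-≡ (∣m∣n⇒∣m-n (∣m⇒∣m*n b p∣a) h) (cancel (a * b)))
  where
  cancel : ∀ x → x - (x - 1ℤ) ≡ 1ℤ
  cancel = solve-∀

*-cancelˡ-≋-prime : ∀ {p} → Prime p → ¬ (+ p ∣ u) → u * a ≋ u * b ⟨mod p ⟩ → a ≋ b ⟨mod p ⟩
*-cancelˡ-≋-prime {u = u} {a = a} {b = b} p-prime p∤u (congruent h) =
  congruent (∣*∤⇒∣ p-prime p∤u (∣-resp-≡ h (factor u a b)))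
  where
  factor : ∀ u a b → u * a - u * b ≡ u * (a - b)
  factor = solve-∀

prime∤! : ∀ {p} → Prime p → ∀ j → j ℕ.< p → ¬ (p ℕD.∣ j !)
prime∤! p-prime zero _ p∣1 = ℕ.<-irrefl (sym (ℕD.∣1⇒≡1 p∣1)) (prime>1 p-prime)
prime∤! p-prime (suc j) j<p p∣j! with euclidsLemma (suc j) (j !) p-prime p∣j!
... | inj₁ p∣1+j = ℕ.<⇒≱ j<p (ℕD.∣⇒≤ p∣1+j)
... | inj₂ p∣j! = prime∤! p-prime j (ℕ.<-trans (ℕ.n<1+n j) j<p) p∣j!

C*!*!≡! : ∀ {n k} → k ℕ.≤ n → (n C k) ℕ.* (k ! ℕ.* (n ℕ.∸ k) !) ≡ n !
C*!*!≡! {n = n} {k = k} k≤n rewrite nCk≡n!/k![n-k]! k≤n =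
  m/n*n≡m {{ℕ._!*_!≢0 k (n ℕ.∸ k)}} (k![n∸k]!∣n! k≤n)

prime∣C : ∀ {p k} → Prime p → 0 ℕ.< k → k ℕ.< p → p ℕD.∣ p C k
prime∣C {suc n} {k} p-prime 0<k k<p
  with euclidsLemma (suc n C k) (k ! ℕ.* (suc n ℕ.∸ k) !) p-prime
         (subst (suc n ℕD.∣_) (sym (C*!*!≡! (ℕ.<⇒≤ k<p))) (ℕD.m∣m*n (n !)))
... | inj₁ p∣C = p∣C
... | inj₂ p∣k!*[p∸k]! with euclidsLemma (k !) ((suc n ℕ.∸ k) !) p-prime p∣k!*[p∸k]!
...   | inj₁ p∣k! = ⊥-elim (prime∤! p-prime k k<p p∣k!)
...   | inj₂ p∣[p∸k]! =
  ⊥-elim (prime∤! p-prime (suc n ℕ.∸ k) (ℕ.∸-monoʳ-< {suc n} {k} {0} 0<k (ℕ.<⇒≤ k<p)) p∣[p∸k]!)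

-- The binomial theorem of the library uses the semiring's own power and multiple, which agree
-- with those of ℤ only propositionally.
^ˢ≡^ : ∀ x n → x ^ˢ n ≡ x ^ n
^ˢ≡^ x zero = refl
^ˢ≡^ x (suc n) = cong (x *_) (^ˢ≡^ x n)

×ˢ≡* : ∀ n x → n ×ˢ x ≡ + n * x
×ˢ≡* zero x = sym (*-zeroˡ x)
×ˢ≡* (suc n) x = begin
  x + n ×ˢ x          ≡⟨ cong (_+_ x) (×ˢ≡* n x) ⟩
  x + + n * x         ≡⟨ cong (_+ + n * x) (sym (*-identityˡ x)) ⟩
  1ℤ * x + + n * x    ≡⟨ sym (*-distribʳ-+ x 1ℤ (+ n)) ⟩
  (1ℤ + + n) * x      ≡⟨ cong (_* x) (sym (pos-+ 1 n)) ⟩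
  + suc n * x         ∎
  where open ≡-Reasoning

sum-≋-last : ∀ m (t : Fin (suc m) → ℤ) → (∀ i → + q ∣ t (inject₁ i)) → sum t ≋ t (fromℕ m) ⟨mod q ⟩
sum-≋-last zero t _ = ≋-reflexive (+-identityʳ (t Fin.zero))
sum-≋-last {q = q} (suc m) t q∣t = begin
  t Fin.zero + sum (t ∘ Fin.suc)
    ≈⟨ +-cong-≋ (∣⇒≋0 (q∣t Fin.zero)) (sum-≋-last m (t ∘ Fin.suc) (q∣t ∘ Fin.suc)) ⟩
  0ℤ + t (fromℕ (suc m))              ≡⟨ +-identityˡ _ ⟩
  t (fromℕ (suc m))                   ∎
  where open ≋-Reasoning q

freshman : ∀ {p} → Prime p → ∀ x y → (x + y) ^ p ≋ x ^ p + y ^ p ⟨mod p ⟩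
freshman {suc n} p-prime x y = begin
  (x + y) ^ p                      ≡⟨ sym (^ˢ≡^ (x + y) p) ⟩
  (x + y) ^ˢ p                     ≡⟨ Binomial.theorem p x y ⟩
  term Fin.zero + sum (term ∘ Fin.suc)  ≈⟨ +-congˡ-≋ (term Fin.zero) (sum-≋-last n (term ∘ Fin.suc) p∣middle) ⟩
  term Fin.zero + term (fromℕ p)   ≈⟨ +-cong-≋ (≋-reflexive first) last ⟩
  y ^ p + x ^ p                    ≡⟨ +-comm (y ^ p) (x ^ p) ⟩
  x ^ p + y ^ p                    ∎
  where
  open ≋-Reasoning (suc n)
  p = suc n
  term : Fin (suc p) → ℤ
  term = binomialTerm x y p
  first : term Fin.zero ≡ y ^ p
  first = trans (+-identityʳ _) (trans (*-identityˡ _) (^ˢ≡^ y p))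
  last : term (fromℕ p) ≋ x ^ p ⟨mod p ⟩
  last = begin
    (p C toℕ (fromℕ p)) ×ˢ (x ^ˢ toℕ (fromℕ p) * y ^ˢ (p ℕ.∸ toℕ (fromℕ p)))
      ≡⟨ cong (λ j → (p C j) ×ˢ (x ^ˢ j * y ^ˢ (p ℕ.∸ j))) (toℕ-fromℕ p) ⟩
    (p C p) ×ˢ (x ^ˢ p * y ^ˢ (p ℕ.∸ p))
      ≡⟨ cong₂ (λ c e → c ×ˢ (x ^ˢ p * y ^ˢ e)) (nCn≡1 p) (ℕ.n∸n≡0 p) ⟩
    x ^ˢ p * 1ℤ + 0ℤ
      ≡⟨ trans (+-identityʳ _) (trans (*-identityʳ _) (^ˢ≡^ x p)) ⟩
    x ^ p ∎
  p∣middle : ∀ i → + p ∣ term (Fin.suc (inject₁ i))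
  p∣middle i = ∣-resp-≡ (∣m⇒∣m*n (binomial x y p (Fin.suc (inject₁ i))) p∣C) (sym (×ˢ≡* (p C k) _))
    where
    k = suc (toℕ (inject₁ i))
    p∣C : + p ∣ + (p C k)
    p∣C = ∣ᵤ⇒∣ (prime∣C p-prime (ℕ.s≤s ℕ.z≤n)
                  (ℕ.s≤s (subst (ℕ._< n) (sym (toℕ-inject₁ i)) (toℕ<n i))))

neg-^-prime : ∀ {p} → Prime p → ∀ a → (- a) ^ p ≋ - (a ^ p) ⟨mod p ⟩
neg-^-prime {suc n} p-prime a = begin
  (- a) ^ p                          ≡⟨ move (a ^ p) ((- a) ^ p) ⟩
  - (a ^ p) + (a ^ p + (- a) ^ p)    ≈⟨ +-congˡ-≋ (- (a ^ p)) (freshman p-prime a (- a)) ⟨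
  - (a ^ p) + (a + - a) ^ p          ≡⟨ cong (λ z → - (a ^ p) + z ^ p) (+-inverseʳ a) ⟩
  - (a ^ p) + 0ℤ                     ≡⟨ +-identityʳ (- (a ^ p)) ⟩
  - (a ^ p)                          ∎
  where
  open ≋-Reasoning (suc n)
  p = suc n
  move : ∀ x y → y ≡ - x + (x + y)
  move = solve-∀

fermat-ℕ : ∀ {p} → Prime p → ∀ n → (+ n) ^ p ≋ + n ⟨mod p ⟩
fermat-ℕ {suc m} p-prime zero = ≋-refl
fermat-ℕ {suc m} p-prime (suc n) = begin
  (1ℤ + + n) ^ p          ≈⟨ freshman p-prime 1ℤ (+ n) ⟩
  1ℤ ^ p + (+ n) ^ p      ≈⟨ +-cong-≋ (≋-reflexive (^-zeroˡ p)) (fermat-ℕ p-prime n) ⟩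
  1ℤ + + n                ∎
  where
  open ≋-Reasoning (suc m)
  p = suc m

fermat : ∀ {p} → Prime p → ∀ a → a ^ p ≋ a ⟨mod p ⟩
fermat p-prime (+ n) = fermat-ℕ p-prime n
fermat p-prime -[1+ n ] = ≋-trans (neg-^-prime p-prime (+ suc n)) (-‿cong-≋ (fermat-ℕ p-prime (suc n)))

fermat-unit : ∀ {p} → Prime p → ¬ (+ p ∣ u) → u ^ (p ℕ.∸ 1) ≋ 1ℤ ⟨mod p ⟩
fermat-unit {u = u} {p = suc m} p-prime p∤u =
  *-cancelˡ-≋-prime p-prime p∤u (≋-trans (fermat p-prime u) (≋-reflexive (sym (*-identityʳ u))))

^-periodic : ∀ {p} → Prime p → ¬ (+ p ∣ u) → ∀ e t → u ^ (e ℕ.+ (p ℕ.∸ 1) ℕ.* t) ≋ u ^ e ⟨mod p ⟩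
^-periodic {u = u} {p = p} p-prime p∤u e t = begin
  u ^ (e ℕ.+ (p ℕ.∸ 1) ℕ.* t)      ≡⟨ ^-distribˡ-+-* u e _ ⟩
  u ^ e * u ^ ((p ℕ.∸ 1) ℕ.* t)    ≡⟨ cong (u ^ e *_) (sym (^-*-assoc u (p ℕ.∸ 1) t)) ⟩
  u ^ e * (u ^ (p ℕ.∸ 1)) ^ t      ≈⟨ *-congˡ-≋ (u ^ e) (^-congˡ-≋ t (fermat-unit p-prime p∤u)) ⟩
  u ^ e * 1ℤ ^ t                   ≡⟨ cong (u ^ e *_) (^-zeroˡ t) ⟩
  u ^ e * 1ℤ                       ≡⟨ *-identityʳ (u ^ e) ⟩
  u ^ e                            ∎
  where open ≋-Reasoning p

≋⇒≡+* : ∀ {e f} → + e ≋ + f ⟨mod q ⟩ → f ℕ.≤ e → Σ ℕ λ t → e ≡ f ℕ.+ q ℕ.* t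
≋⇒≡+* {q = q} {e = e} {f = f} (congruent q∣e-f) f≤e
  with subst (q ℕD.∣_) (cong ∣_∣ (trans (m-n≡m⊖n e f) (⊖-≥ f≤e))) (∣⇒∣ᵤ q∣e-f)
... | ℕD.divides t e∸f≡t*q =
  t , trans (sym (ℕ.m+[n∸m]≡n f≤e)) (cong (f ℕ.+_) (trans e∸f≡t*q (ℕ.*-comm t q)))

^-cong-exponent : ∀ {p e f} → Prime p → ¬ (+ p ∣ u) →
  + e ≋ + f ⟨mod p ℕ.∸ 1 ⟩ → u ^ e ≋ u ^ f ⟨mod p ⟩
^-cong-exponent {e = e} {f = f} p-prime p∤u e≋f with ℕ.≤-total f e
... | inj₁ f≤e with ≋⇒≡+* e≋f f≤e
...   | t , refl = ^-periodic p-prime p∤u f t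
^-cong-exponent {e = e} {f = f} p-prime p∤u e≋f | inj₂ e≤f with ≋⇒≡+* (≋-sym e≋f) e≤f
...   | t , refl = ≋-sym (^-periodic p-prime p∤u e t)

-- Congruences modulo p²

first-order-expansion : + q ∣ d → ∀ w f → (w + d) ^ suc f ≋ w ^ suc f + + suc f * w ^ f * d ⟨mod q ℕ.^ 2 ⟩
first-order-expansion {d = d} q∣d w zero = ≋-reflexive (linear w d)
  where
  linear : ∀ w d → (w + d) * 1ℤ ≡ w * 1ℤ + 1ℤ * 1ℤ * d
  linear = solve-∀
first-order-expansion {q = q} {d = d} q∣d w (suc f) = begin
  (w + d) * (w + d) ^ suc f
    ≈⟨ *-congˡ-≋ (w + d) (first-order-expansion q∣d w f) ⟩
  (w + d) * (w ^ suc f + + suc f * w ^ f * d)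
    ≡⟨ expand w d (w ^ f) (+ suc f) ⟩
  (w ^ suc (suc f) + (1ℤ + + suc f) * w ^ suc f * d) + + suc f * w ^ f * (d * d)
    ≈⟨ +-congˡ-≋ (w ^ suc (suc f) + (1ℤ + + suc f) * w ^ suc f * d)
                 (∣⇒≋0 (∣n⇒∣m*n (+ suc f * w ^ f) (∣-sq q∣d q∣d))) ⟩
  (w ^ suc (suc f) + (1ℤ + + suc f) * w ^ suc f * d) + 0ℤ
    ≡⟨ +-identityʳ _ ⟩
  w ^ suc (suc f) + (1ℤ + + suc f) * w ^ suc f * d
    ≡⟨ cong (λ s → w ^ suc (suc f) + s * w ^ suc f * d) (sym (pos-+ 1 (suc f))) ⟩
  w ^ suc (suc f) + + suc (suc f) * w ^ suc f * d
    ∎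
  where
  open ≋-Reasoning (q ℕ.^ 2)
  expand : ∀ w d v s → (w + d) * (w * v + s * v * d) ≡ (w * (w * v) + (1ℤ + s) * (w * v) * d) + s * v * (d * d)
  expand = solve-∀

^-lift : a ≋ b ⟨mod q ⟩ → a ^ q ≋ b ^ q ⟨mod q ℕ.^ 2 ⟩
^-lift {q = zero} _ = ≋-refl
^-lift {a = a} {b = b} {q = q@(suc f)} (congruent q∣a-b) = begin
  a ^ q                              ≡⟨ cong (_^ q) (split a b) ⟩
  (b + (a - b)) ^ q                  ≈⟨ first-order-expansion q∣a-b b f ⟩
  b ^ q + + q * b ^ f * (a - b)      ≈⟨ +-congˡ-≋ (b ^ q) (∣⇒≋0 (∣-sq (∣m⇒∣m*n (b ^ f) ∣-refl) q∣a-b)) ⟩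
  b ^ q + 0ℤ                         ≡⟨ +-identityʳ (b ^ q) ⟩
  b ^ q                              ∎
  where
  open ≋-Reasoning (q ℕ.^ 2)
  split : ∀ a b → a ≡ b + (a - b)
  split = solve-∀

pth-power-expansion : ∀ {p f} → Prime p → + suc f ≋ u ⟨mod p ⟩ →
  u ^ suc f ≋ (u ^ p) ^ suc f * (1ℤ + (u - u ^ p)) ⟨mod p ℕ.^ 2 ⟩
pth-power-expansion {u = u} {p = p} {f = f} p-prime f+1≋u = begin
  u ^ suc f                          ≡⟨ cong (_^ suc f) (split u ω) ⟩
  (ω + δ) ^ suc f                    ≈⟨ first-order-expansion p∣δ ω f ⟩
  ω ^ suc f + + suc f * ω ^ f * δ    ≈⟨ +-congˡ-≋ (ω ^ suc f) (*-congʳ-≋-sq p∣δ (*-congʳ-≋ (ω ^ f) f+1≋ω)) ⟩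
  ω ^ suc f + ω * ω ^ f * δ          ≡⟨ factor ω (ω ^ f) δ ⟩
  ω ^ suc f * (1ℤ + δ)               ∎
  where
  open ≋-Reasoning (p ℕ.^ 2)
  ω = u ^ p
  δ = u - ω
  p∣δ : + p ∣ δ
  p∣δ = divides-difference (≋-sym (fermat p-prime u))
  f+1≋ω : + suc f ≋ ω ⟨mod p ⟩
  f+1≋ω = ≋-trans f+1≋u (≋-sym (fermat p-prime u))
  split : ∀ u ω → u ≡ ω + (u - ω)
  split = solve-∀
  factor : ∀ ω v δ → ω * v + ω * v * δ ≡ ω * v * (1ℤ + δ)
  factor = solve-∀

pth-power-by-residue : ∀ {p x} → Prime p →
  x ≋ a ^ p ⟨mod p ℕ.^ 2 ⟩ → x ≋ b ⟨mod p ⟩ → x ≋ b ^ p ⟨mod p ℕ.^ 2 ⟩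
pth-power-by-residue {a = a} {b = b} p-prime x≋aᵖ x≋b =
  ≋-trans x≋aᵖ (^-lift (≋-trans (≋-sym (fermat p-prime a)) (≋-trans (≋-sym (≋-weaken-sq x≋aᵖ)) x≋b)))

-- Consequences of D_ε(N, M) ≡ 0

D≋0⇒Nᴺ≋-εVⱽMᴹ : ∀ ε N M → D ε N M ≋ 0ℤ ⟨mod q ⟩ →
  (+ N) ^ N ≋ - ε * ((+ (N ℕ.∸ M)) ^ (N ℕ.∸ M) * (+ M) ^ M) ⟨mod q ⟩
D≋0⇒Nᴺ≋-εVⱽMᴹ {q = q} ε N M D≋0 = begin
  (+ N) ^ N                                    ≡⟨ move ((+ N) ^ N) (ε * W) ⟩
  ((+ N) ^ N + ε * W) - ε * W                  ≡⟨ cong (λ z → z - ε * W) D≡ ⟨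
  D ε N M - ε * W                              ≈⟨ -cong-≋ D≋0 (≋-refl {ε * W}) ⟩
  0ℤ - ε * W                                   ≡⟨ neg-* ε W ⟩
  - ε * W                                      ∎
  where
  open ≋-Reasoning q
  V = N ℕ.∸ M
  W = (+ V) ^ V * (+ M) ^ M
  D≡ : D ε N M ≡ (+ N) ^ N + ε * W
  D≡ = cong₂ (λ s t → s + ε * t) (pos-^ N N)
             (trans (pos-* (V ℕ.^ V) (M ℕ.^ M)) (cong₂ _*_ (pos-^ V V) (pos-^ M M)))
  move : ∀ a b → a ≡ (a + b) - b
  move = solve-∀
  neg-* : ∀ e w → 0ℤ - e * w ≡ - e * w
  neg-* = solve-∀

δ : ℕ → ℕ → ℤ
δ p u = + u - (+ u) ^ p

self-power-expansion : ∀ {p u} → Prime p → 0 ℕ.< u →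
  (+ u) ^ u ≋ ((+ u) ^ p) ^ u * (1ℤ + δ p u) ⟨mod p ℕ.^ 2 ⟩
self-power-expansion {u = suc f} p-prime _ = pth-power-expansion {u = + suc f} p-prime ≋-refl

D≋0⇒expansion : ∀ {p ε N M} → Prime p → 0 ℕ.< M → M ℕ.< N → D ε N M ≋ 0ℤ ⟨mod p ℕ.^ 2 ⟩ →
  ((+ N) ^ p) ^ N * (1ℤ + δ p N) ≋
    - ε * (((+ (N ℕ.∸ M)) ^ p) ^ (N ℕ.∸ M) * ((+ M) ^ p) ^ M) * (1ℤ + δ p (N ℕ.∸ M) + δ p M)
    ⟨mod p ℕ.^ 2 ⟩
D≋0⇒expansion {p} {ε} {N} {M} p-prime 0<M M<N D≋0 = begin
  ((+ N) ^ p) ^ N * (1ℤ + δ p N)                 ≈⟨ self-power-expansion p-prime (ℕ.<-trans 0<M M<N) ⟨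
  (+ N) ^ N                                      ≈⟨ D≋0⇒Nᴺ≋-εVⱽMᴹ ε N M D≋0 ⟩
  - ε * ((+ V) ^ V * (+ M) ^ M)
    ≈⟨ *-congˡ-≋ (- ε) (*-cong-≋ (self-power-expansion p-prime (ℕ.m<n⇒0<n∸m M<N))
                                 (self-power-expansion p-prime 0<M)) ⟩
  - ε * (TV * (1ℤ + δ p V) * (TM * (1ℤ + δ p M)))  ≡⟨ regroup (- ε) TV TM (1ℤ + δ p V) (1ℤ + δ p M) ⟩
  - ε * (TV * TM) * ((1ℤ + δ p V) * (1ℤ + δ p M))
    ≈⟨ *-congˡ-≋ (- ε * (TV * TM)) ([1+a][1+b]≋1+a+b (p∣δ V) (p∣δ M)) ⟩
  - ε * (TV * TM) * (1ℤ + δ p V + δ p M)          ∎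
  where
  open ≋-Reasoning (p ℕ.^ 2)
  V = N ℕ.∸ M
  TV = ((+ V) ^ p) ^ V
  TM = ((+ M) ^ p) ^ M
  p∣δ : ∀ u → + p ∣ δ p u
  p∣δ u = divides-difference (≋-sym (fermat p-prime (+ u)))
  regroup : ∀ e a b x y → e * (a * x * (b * y)) ≡ e * (a * b) * (x * y)
  regroup = solve-∀

D≋0⇒lifted : ∀ {p ε N M} → ¬ (2 ℕD.∣ p) → ε ≡ + 1 ⊎ ε ≡ - (+ 1) → D ε N M ≋ 0ℤ ⟨mod p ⟩ →
  ((+ N) ^ p) ^ N ≋ - ε * (((+ (N ℕ.∸ M)) ^ p) ^ (N ℕ.∸ M) * ((+ M) ^ p) ^ M) ⟨mod p ℕ.^ 2 ⟩
D≋0⇒lifted {p} {ε} {N} {M} odd sign D≋0 = begin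
  ((+ N) ^ p) ^ N                                ≡⟨ ^-comm (+ N) p N ⟩
  ((+ N) ^ N) ^ p                                ≈⟨ ^-lift (D≋0⇒Nᴺ≋-εVⱽMᴹ ε N M D≋0) ⟩
  (- ε * ((+ V) ^ V * (+ M) ^ M)) ^ p            ≡⟨ ^-distrib-* (- ε) ((+ V) ^ V * (+ M) ^ M) p ⟩
  (- ε) ^ p * ((+ V) ^ V * (+ M) ^ M) ^ p
    ≡⟨ cong₂ _*_ (neg-sign^odd p sign odd) (^-distrib-* ((+ V) ^ V) ((+ M) ^ M) p) ⟩
  - ε * (((+ V) ^ V) ^ p * ((+ M) ^ M) ^ p)      ≡⟨ cong (- ε *_) (cong₂ _*_ (^-comm (+ V) V p) (^-comm (+ M) M p)) ⟩
  - ε * (((+ V) ^ p) ^ V * ((+ M) ^ p) ^ M)      ∎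
  where
  open ≋-Reasoning (p ℕ.^ 2)
  V = N ℕ.∸ M

pth-powers-additive : ∀ {p ε N M r} → Prime p → ¬ (2 ℕD.∣ p) → ε ≡ + 1 ⊎ ε ≡ - (+ 1) →
  0 ℕ.< M → M ℕ.< N → + N * r ≋ 1ℤ ⟨mod p ⟩ → D ε N M ≋ 0ℤ ⟨mod p ℕ.^ 2 ⟩ →
  (+ N) ^ p ≋ (+ (N ℕ.∸ M)) ^ p + (+ M) ^ p ⟨mod p ℕ.^ 2 ⟩
pth-powers-additive {p} {ε} {N} {M} {r} p-prime odd sign 0<M M<N Nr≋1 D≋0 = begin
  (+ N) ^ p                                      ≡⟨ split-off ((+ N) ^ p) (+ N) ⟩
  (1ℤ + + N) - (1ℤ + δ p N)                      ≈⟨ -cong-≋ (≋-refl {1ℤ + + N}) δN≋δV+δM ⟩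
  (1ℤ + + N) - (1ℤ + δ p V + δ p M)
    ≡⟨ cong (λ n → (1ℤ + n) - (1ℤ + δ p V + δ p M)) (pos-m∸n+n (ℕ.<⇒≤ M<N)) ⟩
  (1ℤ + (+ V + + M)) - (1ℤ + δ p V + δ p M)      ≡⟨ cancel (+ V) (+ M) ((+ V) ^ p) ((+ M) ^ p) ⟩
  (+ V) ^ p + (+ M) ^ p                          ∎
  where
  open ≋-Reasoning (p ℕ.^ 2)
  V = N ℕ.∸ M
  A = ((+ N) ^ p) ^ N
  A-invertible : A * (r ^ p) ^ N ≋ 1ℤ ⟨mod p ℕ.^ 2 ⟩
  A-invertible = begin
    A * (r ^ p) ^ N              ≡⟨ ^-distrib-* ((+ N) ^ p) (r ^ p) N ⟨
    ((+ N) ^ p * r ^ p) ^ N      ≡⟨ cong (_^ N) (^-distrib-* (+ N) r p) ⟨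
    ((+ N * r) ^ p) ^ N          ≈⟨ ^-congˡ-≋ N (^-lift Nr≋1) ⟩
    (1ℤ ^ p) ^ N                 ≡⟨ trans (cong (_^ N) (^-zeroˡ p)) (^-zeroˡ N) ⟩
    1ℤ                           ∎
  δN≋δV+δM : 1ℤ + δ p N ≋ 1ℤ + δ p V + δ p M ⟨mod p ℕ.^ 2 ⟩
  δN≋δV+δM = invertible-cancelˡ-≋ {u = A} {v = (r ^ p) ^ N} A-invertible
    (≋-trans (D≋0⇒expansion {ε = ε} p-prime 0<M M<N D≋0)
      (*-congʳ-≋ (1ℤ + δ p V + δ p M)
        (≋-sym (D≋0⇒lifted {ε = ε} {N = N} {M = M} odd sign (≋-weaken-sq D≋0)))))
  split-off : ∀ t n → t ≡ (1ℤ + n) - (1ℤ + (n - t))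
  split-off = solve-∀
  cancel : ∀ v m s t → (1ℤ + (v + m)) - (1ℤ + (v - s) + (m - t)) ≡ s + t
  cancel = solve-∀

D≋0⇒∤N∸M : ∀ {p ε N M} → Prime p → M ℕ.< N → ¬ (+ p ∣ + N) → D ε N M ≋ 0ℤ ⟨mod p ⟩ →
  ¬ (+ p ∣ + (N ℕ.∸ M))
D≋0⇒∤N∸M {p} {ε} {N} {M} p-prime M<N p∤N D≋0 p∣V = ∤-^ p-prime N p∤N (≋0⇒∣ (begin
  (+ N) ^ N                                     ≈⟨ D≋0⇒Nᴺ≋-εVⱽMᴹ ε N M D≋0 ⟩
  - ε * ((+ V) ^ V * (+ M) ^ M)
    ≈⟨ *-congˡ-≋ (- ε) (*-congʳ-≋ ((+ M) ^ M) (∣⇒≋0 (p∣Vⱽ V (ℕ.m<n⇒0<n∸m M<N)))) ⟩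
  - ε * (0ℤ * (+ M) ^ M)                        ≡⟨ *-zeroʳ (- ε) ⟩
  0ℤ                                            ∎))
  where
  open ≋-Reasoning p
  V = N ℕ.∸ M
  p∣Vⱽ : ∀ e → 0 ℕ.< e → + p ∣ (+ V) ^ e
  p∣Vⱽ (suc e) _ = ∣m⇒∣m*n ((+ V) ^ e) p∣V

D≋0⇒1≋-ε[Vr]ⱽ[Mr]ᴹ : ∀ {ε N M r} → M ℕ.< N → + N * r ≋ 1ℤ ⟨mod q ⟩ → D ε N M ≋ 0ℤ ⟨mod q ⟩ →
  1ℤ ≋ - ε * ((+ (N ℕ.∸ M) * r) ^ (N ℕ.∸ M) * (+ M * r) ^ M) ⟨mod q ⟩
D≋0⇒1≋-ε[Vr]ⱽ[Mr]ᴹ {q} {ε} {N} {M} {r} M<N Nr≋1 D≋0 = begin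
  1ℤ                                       ≡⟨ ^-zeroˡ N ⟨
  1ℤ ^ N                                   ≈⟨ ^-congˡ-≋ N Nr≋1 ⟨
  (+ N * r) ^ N                            ≡⟨ ^-distrib-* (+ N) r N ⟩
  (+ N) ^ N * r ^ N                        ≈⟨ *-congʳ-≋ (r ^ N) (D≋0⇒Nᴺ≋-εVⱽMᴹ ε N M D≋0) ⟩
  - ε * W * r ^ N                          ≡⟨ cong (λ e → - ε * W * r ^ e) (ℕ.m∸n+n≡m (ℕ.<⇒≤ M<N)) ⟨
  - ε * W * r ^ (V ℕ.+ M)                  ≡⟨ cong (- ε * W *_) (^-distribˡ-+-* r V M) ⟩
  - ε * W * (r ^ V * r ^ M)                ≡⟨ regroup (- ε) ((+ V) ^ V) ((+ M) ^ M) (r ^ V) (r ^ M) ⟩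
  - ε * ((+ V) ^ V * r ^ V * ((+ M) ^ M * r ^ M))
    ≡⟨ cong (- ε *_) (cong₂ _*_ (^-distrib-* (+ V) r V) (^-distrib-* (+ M) r M)) ⟨
  - ε * ((+ V * r) ^ V * (+ M * r) ^ M)    ∎
  where
  open ≋-Reasoning q
  V = N ℕ.∸ M
  W = (+ V) ^ V * (+ M) ^ M
  regroup : ∀ e a b s t → e * (a * b) * (s * t) ≡ e * (a * s * (b * t))
  regroup = solve-∀

D≋0⇒[Vr]ᵏ≋-ε[Mr]ᵐ : ∀ {p ε N M r k m} → Prime p → 0 ℕ.< M → M ℕ.< N → + N * r ≋ 1ℤ ⟨mod p ⟩ →
  ¬ (+ p ∣ + M) → D ε N M ≋ 0ℤ ⟨mod p ⟩ →
  + (k ℕ.+ (N ℕ.∸ M)) ≋ 0ℤ ⟨mod p ℕ.∸ 1 ⟩ → + M ≋ + m ⟨mod p ℕ.∸ 1 ⟩ →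
  (+ (N ℕ.∸ M) * r) ^ k ≋ - ε * (+ M * r) ^ m ⟨mod p ⟩
D≋0⇒[Vr]ᵏ≋-ε[Mr]ᵐ {p} {ε} {N} {M} {r} {k} {m} p-prime 0<M M<N Nr≋1 p∤M D≋0 k+V≋0 M≋m = begin
  v ^ k                              ≡⟨ sym (*-identityʳ (v ^ k)) ⟩
  v ^ k * 1ℤ                         ≈⟨ *-congˡ-≋ (v ^ k) (D≋0⇒1≋-ε[Vr]ⱽ[Mr]ᴹ {ε = ε} M<N Nr≋1 D≋0) ⟩
  v ^ k * (- ε * (v ^ V * w ^ M))    ≡⟨ regroup (v ^ k) (- ε) (v ^ V) (w ^ M) ⟩
  - ε * (v ^ k * v ^ V * w ^ M)      ≡⟨ cong (λ z → - ε * (z * w ^ M)) (sym (^-distribˡ-+-* v k V)) ⟩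
  - ε * (v ^ (k ℕ.+ V) * w ^ M)
    ≈⟨ *-congˡ-≋ (- ε) (*-cong-≋ (^-cong-exponent p-prime p∤v k+V≋0) (^-cong-exponent p-prime p∤w M≋m)) ⟩
  - ε * (1ℤ * w ^ m)                 ≡⟨ cong (- ε *_) (*-identityˡ (w ^ m)) ⟩
  - ε * w ^ m                        ∎
  where
  open ≋-Reasoning p
  V = N ℕ.∸ M
  v = + V * r
  w = + M * r
  p∤N : ¬ (+ p ∣ + N)
  p∤N = invertible⇒∤ p-prime Nr≋1
  p∤r : ¬ (+ p ∣ r)
  p∤r = invertible⇒∤ p-prime (≋-trans (≋-reflexive (*-comm r (+ N))) Nr≋1)
  p∤v : ¬ (+ p ∣ v)
  p∤v = ∤-* p-prime (D≋0⇒∤N∸M {ε = ε} p-prime M<N p∤N D≋0) p∤r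
  p∤w : ¬ (+ p ∣ w)
  p∤w = ∤-* p-prime p∤M p∤r
  regroup : ∀ a e b c → a * (e * (b * c)) ≡ e * (a * b * c)
  regroup = solve-∀

lift-power-identity : ∀ {p ε k m x v w} → ¬ (2 ℕD.∣ p) → ε ≡ + 1 ⊎ ε ≡ - (+ 1) →
  x ≋ v ^ p ⟨mod p ℕ.^ 2 ⟩ → 1ℤ - x ≋ w ^ p ⟨mod p ℕ.^ 2 ⟩ → v ^ k ≋ - ε * w ^ m ⟨mod p ⟩ →
  x ^ k ≋ - (ε * (1ℤ - x) ^ m) ⟨mod p ℕ.^ 2 ⟩
lift-power-identity {p} {ε} {k} {m} {x} {v} {w} odd sign x≋vᵖ 1-x≋wᵖ vᵏ≋-εwᵐ = begin
  x ^ k                      ≈⟨ ^-congˡ-≋ k x≋vᵖ ⟩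
  (v ^ p) ^ k                ≡⟨ ^-comm v p k ⟩
  (v ^ k) ^ p                ≈⟨ ^-lift vᵏ≋-εwᵐ ⟩
  (- ε * w ^ m) ^ p          ≡⟨ ^-distrib-* (- ε) (w ^ m) p ⟩
  (- ε) ^ p * (w ^ m) ^ p    ≡⟨ cong₂ _*_ (neg-sign^odd p sign odd) (^-comm w m p) ⟩
  - ε * (w ^ p) ^ m          ≈⟨ *-congˡ-≋ (- ε) (^-congˡ-≋ m 1-x≋wᵖ) ⟨
  - ε * (1ℤ - x) ^ m         ≡⟨ neg-distribˡ-* ε ((1ℤ - x) ^ m) ⟨
  - (ε * (1ℤ - x) ^ m)       ∎
  where open ≋-Reasoning (p ℕ.^ 2)

exponent-sum≋0 : ∀ {k m N M n} → M ℕ.≤ N →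
  + k ≋ + m - n ⟨mod q ⟩ → + N ≋ n ⟨mod q ⟩ → + M ≋ + m ⟨mod q ⟩ →
  + (k ℕ.+ (N ℕ.∸ M)) ≋ 0ℤ ⟨mod q ⟩
exponent-sum≋0 {q} {k} {m} {N} {M} {n} M≤N k≋m-n N≋n M≋m = begin
  + (k ℕ.+ V)                ≡⟨ pos-+ k V ⟩
  + k + + V                  ≡⟨ cong (λ z → + k + z) (move (+ V) (+ M)) ⟩
  + k + ((+ V + + M) - + M)  ≡⟨ cong (λ z → + k + (z - + M)) (pos-m∸n+n M≤N) ⟨
  + k + (+ N - + M)          ≈⟨ +-cong-≋ k≋m-n (-cong-≋ N≋n M≋m) ⟩
  (+ m - n) + (n - + m)      ≡⟨ cancel (+ m) n ⟩
  0ℤ                         ∎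
  where
  open ≋-Reasoning q
  V = N ℕ.∸ M
  move : ∀ v m → v ≡ (v + m) - m
  move = solve-∀
  cancel : ∀ m n → (m - n) + (n - m) ≡ 0ℤ
  cancel = solve-∀

corollary-for-representatives : ∀ {p ε N M r k m x} → Prime p → ¬ (2 ℕD.∣ p) → ε ≡ + 1 ⊎ ε ≡ - (+ 1) →
  0 ℕ.< M → M ℕ.< N → ¬ (+ p ∣ + M) → D ε N M ≋ 0ℤ ⟨mod p ℕ.^ 2 ⟩ → + N * r ≋ 1ℤ ⟨mod p ⟩ →
  + (k ℕ.+ (N ℕ.∸ M)) ≋ 0ℤ ⟨mod p ℕ.∸ 1 ⟩ → + M ≋ + m ⟨mod p ℕ.∸ 1 ⟩ →
  IsPthPowerModSq p x → x ≋ 1ℤ - + M * r ⟨mod p ⟩ →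
  x ^ k ≋ - (ε * (1ℤ - x) ^ m) ⟨mod p ℕ.^ 2 ⟩ × x - 1ℤ ≋ (- (+ M * r)) ^ p ⟨mod p ℕ.^ 2 ⟩
corollary-for-representatives {p} {ε} {N} {M} {r} {k} {m} {x}
  p-prime odd sign 0<M M<N p∤M D≋0 Nr≋1 k+V≋0 M≋m (t , x≈tᵖ) x≋1-Mr =
  lift-power-identity {k = k} {m = m} odd sign x≋vᵖ 1-x≋wᵖ vᵏ≋-εwᵐ , x-1≋[-w]ᵖ
  where
  V = N ℕ.∸ M
  v = + V * r
  w = + M * r
  x≋vᵖ : x ≋ v ^ p ⟨mod p ℕ.^ 2 ⟩
  x≋vᵖ = pth-power-by-residue p-prime (≈⇒≋ x≈tᵖ) (begin
    x                    ≈⟨ x≋1-Mr ⟩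
    1ℤ - + M * r         ≈⟨ -cong-≋ Nr≋1 (≋-refl {+ M * r}) ⟨
    + N * r - + M * r    ≡⟨ cong (λ z → z * r - + M * r) (pos-m∸n+n (ℕ.<⇒≤ M<N)) ⟩
    (+ V + + M) * r - + M * r  ≡⟨ cancel (+ V) (+ M) r ⟩
    v                    ∎)
    where
    open ≋-Reasoning p
    cancel : ∀ v m r → (v + m) * r - m * r ≡ v * r
    cancel = solve-∀
  vᵖ+wᵖ≋1 : v ^ p + w ^ p ≋ 1ℤ ⟨mod p ℕ.^ 2 ⟩
  vᵖ+wᵖ≋1 = begin
    v ^ p + w ^ p                       ≡⟨ cong₂ _+_ (^-distrib-* (+ V) r p) (^-distrib-* (+ M) r p) ⟩
    (+ V) ^ p * r ^ p + (+ M) ^ p * r ^ p  ≡⟨ *-distribʳ-+ (r ^ p) ((+ V) ^ p) ((+ M) ^ p) ⟨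
    ((+ V) ^ p + (+ M) ^ p) * r ^ p
      ≈⟨ *-congʳ-≋ (r ^ p) (pth-powers-additive p-prime odd sign 0<M M<N Nr≋1 D≋0) ⟨
    (+ N) ^ p * r ^ p                   ≡⟨ ^-distrib-* (+ N) r p ⟨
    (+ N * r) ^ p                       ≈⟨ ^-lift Nr≋1 ⟩
    1ℤ ^ p                              ≡⟨ ^-zeroˡ p ⟩
    1ℤ                                  ∎
    where open ≋-Reasoning (p ℕ.^ 2)
  1-x≋wᵖ : 1ℤ - x ≋ w ^ p ⟨mod p ℕ.^ 2 ⟩
  1-x≋wᵖ = ≋-trans (-cong-≋ (≋-sym vᵖ+wᵖ≋1) x≋vᵖ) (≋-reflexive (cancel (v ^ p) (w ^ p)))
    where
    cancel : ∀ a b → (a + b) - a ≡ b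
    cancel = solve-∀
  vᵏ≋-εwᵐ : v ^ k ≋ - ε * w ^ m ⟨mod p ⟩
  vᵏ≋-εwᵐ = D≋0⇒[Vr]ᵏ≋-ε[Mr]ᵐ {ε = ε} p-prime 0<M M<N Nr≋1 p∤M (≋-weaken-sq D≋0) k+V≋0 M≋m
  x-1≋[-w]ᵖ : x - 1ℤ ≋ (- w) ^ p ⟨mod p ℕ.^ 2 ⟩
  x-1≋[-w]ᵖ = begin
    x - 1ℤ          ≡⟨ negate x ⟩
    - (1ℤ - x)      ≈⟨ -‿cong-≋ 1-x≋wᵖ ⟩
    - (w ^ p)       ≡⟨ ^-neg-odd p odd w ⟨
    (- w) ^ p       ∎
    where
    open ≋-Reasoning (p ℕ.^ 2)
    negate : ∀ x → x - 1ℤ ≡ - (1ℤ - x)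
    negate = solve-∀

corollary3p4 : (p : ℕ) → Prime p → ¬ (2 ℕD.∣ p) →
    (m : ℕ) → 0 ℕ.< m → ¬ (p ℕD.∣ m) →
    (ε : ℤ) → (ε ≡ + 1 ⊎ ε ≡ - (+ 1)) →
    (n : ℤ) → PSqDividesD p ε n (+ m) →
    (k : ℕ) → (+ k) ≈ (+ m) - n [mod p ℕ.* (p ℕ.∸ 1) ] →
    (x : ℤ) → IsPthPowerModSq p x →
    (Σ ℤ λ ninv → (n * ninv ≈ + 1 [mod p ]) × (x ≈ + 1 - (+ m) * ninv [mod p ])) →
    (x ^ k ≈ - (ε * (+ 1 - x) ^ m) [mod p ℕ.^ 2 ]) × IsPthPowerModSq p (x - + 1)
corollary3p4 p p-prime odd m _ p∤m ε sign n (N , M , 0<M , M<N , N≈n , M≈m , p²∣D)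
             k k≈m-n x x-pth-power (r , nr≈1 , x≈1-mr) =
  let (xᵏ≋-ε[1-x]ᵐ , x-1≋[-Mr]ᵖ) = corollary-for-representatives {k = k} {m = m} p-prime odd sign 0<M M<N p∤M
                                      (∣⇒≋0 (∣ᵤ⇒∣ p²∣D)) Nr≋1 k+V≋0 (mod-p-1 M≋m) x-pth-power x≋1-Mr
  in ≋⇒≈ xᵏ≋-ε[1-x]ᵐ , - (+ M * r) , ≋⇒≈ x-1≋[-Mr]ᵖ
  where
  N≋n : + N ≋ n ⟨mod p ℕ.* (p ℕ.∸ 1) ⟩
  N≋n = ≈⇒≋ N≈n
  M≋m : + M ≋ + m ⟨mod p ℕ.* (p ℕ.∸ 1) ⟩
  M≋m = ≈⇒≋ M≈m
  k≋m-n : + k ≋ + m - n ⟨mod p ℕ.* (p ℕ.∸ 1) ⟩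
  k≋m-n = ≈⇒≋ k≈m-n
  mod-p : a ≋ b ⟨mod p ℕ.* (p ℕ.∸ 1) ⟩ → a ≋ b ⟨mod p ⟩
  mod-p = ≋-weaken (ℕD.m∣m*n (p ℕ.∸ 1))
  mod-p-1 : a ≋ b ⟨mod p ℕ.* (p ℕ.∸ 1) ⟩ → a ≋ b ⟨mod p ℕ.∸ 1 ⟩
  mod-p-1 = ≋-weaken (ℕD.n∣m*n p)
  Nr≋1 : + N * r ≋ 1ℤ ⟨mod p ⟩
  Nr≋1 = ≋-trans (*-congʳ-≋ r (mod-p N≋n)) (≈⇒≋ nr≈1)
  p∤M : ¬ (+ p ∣ + M)
  p∤M = ∤-cong (mod-p M≋m) (p∤m ∘ ∣⇒∣ᵤ)
  k+V≋0 : + (k ℕ.+ (N ℕ.∸ M)) ≋ 0ℤ ⟨mod p ℕ.∸ 1 ⟩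
  k+V≋0 = exponent-sum≋0 (ℕ.<⇒≤ M<N) (mod-p-1 k≋m-n) (mod-p-1 N≋n) (mod-p-1 M≋m)
  x≋1-mr : x ≋ 1ℤ - + m * r ⟨mod p ⟩
  x≋1-mr = ≈⇒≋ x≈1-mr
  x≋1-Mr : x ≋ 1ℤ - + M * r ⟨mod p ⟩
  x≋1-Mr = ≋-trans x≋1-mr (-cong-≋ (≋-refl {1ℤ}) (*-congʳ-≋ r (≋-sym (mod-p M≋m))))
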